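{- Let $g(x),f(x)$ be formal power series with integer coefficients and $g(0)=f(0)=1$, let $A=(g(x),xf(x))$ with entries $a_{n,k}=[x^n]g(x)(xf(x))^k$, and let $\phi(x)$ be the reversion of $x/f(x)$. Let $c(A;1)$ be the lower-triangular matrix with $(n,k)$ entry $a_{2n,n+k}$. Then $$c(A;1)=\left(\phi'(x)\frac{g(\phi(x))}{f(\phi(x))},\ \phi(x)f(\phi(x))\right).$$
   Context: A Riordan array $(d(x),h(x))$, for formal power series $d,h$ with $d(0)\neq 0$, $h(0)=0$, $h'(0)\neq 0$, is the infinite lower-triangular matrix whose $(n,k)$ entry is $[x^n]d(x)h(x)^k$. The reversion of a power series $h$ with $h(0)=0$, $h'(0)\neq0$ is the power series $u$ with $u(0)=0$ and $h(u(x))=x$. $\phi'$ denotes the derivative of $\phi$. -}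

module Defs where

open import Data.Nat using (ℕ; zero; suc; _∸_)
open import Data.Integer using (ℤ; +_; _+_; _*_)
open import Relation.Binary.PropositionalEquality using (_≡_)

-- Formal power series with integer coefficients: n ↦ [x^n]
PS : Set
PS = ℕ → ℤ

sumTo : ℕ → (ℕ → ℤ) → ℤ
sumTo zero f = f 0
sumTo (suc n) f = sumTo n f + f (suc n)

_≈_ : PS → PS → Set
a ≈ b = ∀ n → a n ≡ b n

one : PS
one zero = + 1
one (suc _) = + 0

X : PS
X (suc zero) = + 1
X _ = + 0

_⊛_ : PS → PS → PS
(a ⊛ b) n = sumTo n (λ i → a i * b (n ∸ i))

pow : PS → ℕ → PS
pow a zero = one
pow a (suc k) = a ⊛ pow a k

-- composition a(u(x)), meaningful when u(0) = 0
compose : PS → PS → PS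
compose a u n = sumTo n (λ k → a k * pow u k n)

deriv : PS → PS
deriv a n = (+ suc n) * a (suc n)

riordan : PS → PS → ℕ → ℕ → ℤ
riordan d h n k = (d ⊛ pow h k) n

{-# OPTIONS --safe #-}
-- Write u = f(φ) and v = 1/u, so that φ = x u, x/φ = v and g(φ) = q u.  Since
-- (x f)^(n+k) = x^(n+k) f^(n+k), for n = k + N the entry a(2n, n+k) is [x^N] g f^(n+k)
-- (for k > n both entries vanish for the same reason).
-- Lagrange inversion in the form  [x^N] P = [x^N] P(φ) φ′ v^(N+1)  turns this into
-- [x^N] φ′ q u^(2k), which is the (n, k) entry of (φ′ q, φ u) = (φ′ q, x u²).
-- Lagrange inversion itself comes down to [x^e] v^(e+1) φ′ = δ(e, 0): with θ = x d/dx,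
-- v^(e+1) φ′ = v^e + v^(e+1) θu and θ(v^e) = -e v^(e+1) θu, so e times this coefficient vanishes.
module Submission where

open import Defs
open import Data.Nat using (ℕ; _+_; _*_)
open import Data.Integer using (ℤ; +_)
open import Relation.Binary.PropositionalEquality using (_≡_)

open import Data.Nat using (zero; suc; _∸_; _≤_; _<_; z≤n; s≤s; _≤?_)
import Data.Nat.Properties as ℕₚ
open import Data.Nat.Induction using (<-rec)
import Data.Nat.Tactic.RingSolver as ℕ-Solver
open import Data.Integer using () renaming (_+_ to _+ᶻ_; _*_ to _*ᶻ_; -_ to -ᶻ_)
import Data.Integer.Properties as ℤₚ
open import Data.Integer.Tactic.RingSolver using (solve-∀)
open import Data.Product using (_,_)
open import Data.Maybe using (Maybe; just; nothing)
open import Relation.Nullary using (yes; no)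
open import Relation.Binary.PropositionalEquality
  using (refl; sym; trans; cong; cong₂; subst; module ≡-Reasoning)
open import Algebra.Bundles using (CommutativeRing)
import Algebra.Structures
import Algebra.Solver.Ring.AlmostCommutativeRing as ACR
import Relation.Binary.Reasoning.Setoid as SetoidReasoning

sumTo-cong≤ : ∀ n {f g : ℕ → ℤ} → (∀ i → i ≤ n → f i ≡ g i) → sumTo n f ≡ sumTo n g
sumTo-cong≤ zero    f≡g = f≡g 0 z≤n
sumTo-cong≤ (suc n) f≡g =
  cong₂ _+ᶻ_ (sumTo-cong≤ n (λ i i≤n → f≡g i (ℕₚ.m≤n⇒m≤1+n i≤n))) (f≡g (suc n) ℕₚ.≤-refl)

sumTo-cong : ∀ n {f g : ℕ → ℤ} → (∀ i → f i ≡ g i) → sumTo n f ≡ sumTo n g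
sumTo-cong n f≡g = sumTo-cong≤ n (λ i _ → f≡g i)

sumTo-+ : ∀ n (f g : ℕ → ℤ) → sumTo n (λ i → f i +ᶻ g i) ≡ sumTo n f +ᶻ sumTo n g
sumTo-+ zero    f g = refl
sumTo-+ (suc n) f g =
  trans (cong (_+ᶻ (f (suc n) +ᶻ g (suc n))) (sumTo-+ n f g))
        (interchange (sumTo n f) (sumTo n g) (f (suc n)) (g (suc n)))
  where
  interchange : ∀ a b c d → (a +ᶻ b) +ᶻ (c +ᶻ d) ≡ (a +ᶻ c) +ᶻ (b +ᶻ d)
  interchange = solve-∀

sumTo-*ˡ : ∀ n c (f : ℕ → ℤ) → c *ᶻ sumTo n f ≡ sumTo n (λ i → c *ᶻ f i)
sumTo-*ˡ zero    c f = refl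
sumTo-*ˡ (suc n) c f =
  trans (ℤₚ.*-distribˡ-+ c (sumTo n f) (f (suc n))) (cong (_+ᶻ (c *ᶻ f (suc n))) (sumTo-*ˡ n c f))

sumTo-*ʳ : ∀ n c (f : ℕ → ℤ) → sumTo n f *ᶻ c ≡ sumTo n (λ i → f i *ᶻ c)
sumTo-*ʳ n c f =
  trans (ℤₚ.*-comm (sumTo n f) c) (trans (sumTo-*ˡ n c f) (sumTo-cong n (λ i → ℤₚ.*-comm c (f i))))

sumTo-zero : ∀ n {f : ℕ → ℤ} → (∀ i → i ≤ n → f i ≡ + 0) → sumTo n f ≡ + 0
sumTo-zero zero    f≡0 = f≡0 0 z≤n
sumTo-zero (suc n) f≡0 =
  cong₂ _+ᶻ_ (sumTo-zero n (λ i i≤n → f≡0 i (ℕₚ.m≤n⇒m≤1+n i≤n))) (f≡0 (suc n) ℕₚ.≤-refl)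

sumTo-suc : ∀ n (f : ℕ → ℤ) → sumTo (suc n) f ≡ f 0 +ᶻ sumTo n (λ i → f (suc i))
sumTo-suc zero    f = refl
sumTo-suc (suc n) f = trans (cong (_+ᶻ f (suc (suc n))) (sumTo-suc n f)) (ℤₚ.+-assoc (f 0) _ _)

sumTo-last : ∀ n {f : ℕ → ℤ} → (∀ i → i < n → f i ≡ + 0) → sumTo n f ≡ f n
sumTo-last zero    _   = refl
sumTo-last (suc n) {f} f≡0 =
  trans (cong (_+ᶻ f (suc n)) (sumTo-zero n (λ i i≤n → f≡0 i (s≤s i≤n)))) (ℤₚ.+-identityˡ _)

sumTo-pad : ∀ m k {f : ℕ → ℤ} → (∀ i → m < i → f i ≡ + 0) → sumTo m f ≡ sumTo (m + k) f
sumTo-pad m zero    {f} _   = cong (λ t → sumTo t f) (sym (ℕₚ.+-identityʳ m))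
sumTo-pad m (suc k) {f} f≡0 =
  trans (sym (ℤₚ.+-identityʳ _))
    (trans (cong₂ _+ᶻ_ (sumTo-pad m k f≡0) (sym (f≡0 (suc (m + k)) (s≤s (ℕₚ.m≤m+n m k)))))
           (cong (λ t → sumTo t f) (sym (ℕₚ.+-suc m k))))

sumTo-swap : ∀ n m (F : ℕ → ℕ → ℤ) →
  sumTo n (λ i → sumTo m (F i)) ≡ sumTo m (λ j → sumTo n (λ i → F i j))
sumTo-swap zero    m F = refl
sumTo-swap (suc n) m F =
  trans (cong (_+ᶻ sumTo m (F (suc n))) (sumTo-swap n m F))
        (sym (sumTo-+ m (λ j → sumTo n (λ i → F i j)) (F (suc n))))

-- The ring of formal power series

infixl 6 _⊕_
infix  8 ⊝_

_⊕_ : PS → PS → PS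
(a ⊕ b) n = a n +ᶻ b n

⊝_ : PS → PS
(⊝ a) n = -ᶻ a n

𝟘 : PS
𝟘 _ = + 0

C : ℤ → PS
C c zero    = c
C c (suc _) = + 0

shift : PS → PS
shift a n = a (suc n)

≈-refl : ∀ {a} → a ≈ a
≈-refl n = refl

≈-sym : ∀ {a b} → a ≈ b → b ≈ a
≈-sym p n = sym (p n)

≈-trans : ∀ {a b c} → a ≈ b → b ≈ c → a ≈ c
≈-trans p q n = trans (p n) (q n)

one≈C1 : one ≈ C (+ 1)
one≈C1 zero    = refl
one≈C1 (suc _) = refl

⊛-suc : ∀ a b n → (a ⊛ b) (suc n) ≡ a 0 *ᶻ b (suc n) +ᶻ (shift a ⊛ b) n
⊛-suc a b n = sumTo-suc n (λ i → a i *ᶻ b (suc n ∸ i))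

⊛-sucʳ : ∀ a b n → (a ⊛ b) (suc n) ≡ (a ⊛ shift b) n +ᶻ a (suc n) *ᶻ b 0
⊛-sucʳ a b n =
  cong₂ _+ᶻ_ (sumTo-cong≤ n (λ i i≤n → cong (λ t → a i *ᶻ b t) (ℕₚ.+-∸-assoc 1 i≤n)))
             (cong (λ t → a (suc n) *ᶻ b t) (ℕₚ.n∸n≡0 n))

⊛-cong≤ˡ : ∀ {a a′} b n → (∀ i → i ≤ n → a i ≡ a′ i) → (a ⊛ b) n ≡ (a′ ⊛ b) n
⊛-cong≤ˡ b n eq = sumTo-cong≤ n (λ i i≤n → cong (_*ᶻ b (n ∸ i)) (eq i i≤n))

⊛-cong≤ʳ : ∀ a {b b′} n → (∀ i → i ≤ n → b i ≡ b′ i) → (a ⊛ b) n ≡ (a ⊛ b′) n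
⊛-cong≤ʳ a n eq = sumTo-cong≤ n (λ i i≤n → cong (a i *ᶻ_) (eq (n ∸ i) (ℕₚ.m∸n≤m n i)))

⊛-cong : ∀ {a a′ b b′} → a ≈ a′ → b ≈ b′ → (a ⊛ b) ≈ (a′ ⊛ b′)
⊛-cong {a′ = a′} {b = b} p q n =
  trans (⊛-cong≤ˡ b n (λ i _ → p i)) (⊛-cong≤ʳ a′ n (λ i _ → q i))

⊛-comm : ∀ a b → (a ⊛ b) ≈ (b ⊛ a)
⊛-comm a b zero    = ℤₚ.*-comm (a 0) (b 0)
⊛-comm a b (suc n) = begin
  (a ⊛ b) (suc n)                          ≡⟨ ⊛-suc a b n ⟩
  a 0 *ᶻ b (suc n) +ᶻ (shift a ⊛ b) n      ≡⟨ cong₂ _+ᶻ_ (ℤₚ.*-comm (a 0) (b (suc n)))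
                                                         (⊛-comm (shift a) b n) ⟩
  b (suc n) *ᶻ a 0 +ᶻ (b ⊛ shift a) n      ≡⟨ ℤₚ.+-comm (b (suc n) *ᶻ a 0) _ ⟩
  (b ⊛ shift a) n +ᶻ b (suc n) *ᶻ a 0      ≡⟨ sym (⊛-sucʳ b a n) ⟩
  (b ⊛ a) (suc n)                          ∎
  where open ≡-Reasoning

⊛-distribˡ : ∀ a b c → (a ⊛ (b ⊕ c)) ≈ ((a ⊛ b) ⊕ (a ⊛ c))
⊛-distribˡ a b c n =
  trans (sumTo-cong n (λ i → ℤₚ.*-distribˡ-+ (a i) (b (n ∸ i)) (c (n ∸ i)))) (sumTo-+ n _ _)

⊛-distribʳ : ∀ a b c → ((b ⊕ c) ⊛ a) ≈ ((b ⊛ a) ⊕ (c ⊛ a))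
⊛-distribʳ a b c n =
  trans (⊛-comm (b ⊕ c) a n)
        (trans (⊛-distribˡ a b c n) (cong₂ _+ᶻ_ (⊛-comm a b n) (⊛-comm a c n)))

C-⊛ : ∀ c b n → (C c ⊛ b) n ≡ c *ᶻ b n
C-⊛ c b zero    = refl
C-⊛ c b (suc n) =
  trans (⊛-suc (C c) b n)
        (trans (cong (c *ᶻ b (suc n) +ᶻ_) (sumTo-zero n (λ i _ → ℤₚ.*-zeroˡ (b (n ∸ i)))))
               (ℤₚ.+-identityʳ _))

⊛-assoc : ∀ a b c → ((a ⊛ b) ⊛ c) ≈ (a ⊛ (b ⊛ c))
⊛-assoc a b c zero    = ℤₚ.*-assoc (a 0) (b 0) (c 0)
⊛-assoc a b c (suc n) = begin
  ((a ⊛ b) ⊛ c) (suc n)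
    ≡⟨ ⊛-suc (a ⊛ b) c n ⟩
  a₀b₀ *ᶻ c (suc n) +ᶻ (shift (a ⊛ b) ⊛ c) n
    ≡⟨ cong (a₀b₀ *ᶻ c (suc n) +ᶻ_) (⊛-cong≤ˡ c n (λ i _ →
              trans (⊛-suc a b i) (cong (_+ᶻ (shift a ⊛ b) i) (sym (C-⊛ (a 0) (shift b) i))))) ⟩
  a₀b₀ *ᶻ c (suc n) +ᶻ (((C (a 0) ⊛ shift b) ⊕ (shift a ⊛ b)) ⊛ c) n
    ≡⟨ cong (a₀b₀ *ᶻ c (suc n) +ᶻ_) (⊛-distribʳ c (C (a 0) ⊛ shift b) (shift a ⊛ b) n) ⟩
  a₀b₀ *ᶻ c (suc n) +ᶻ (((C (a 0) ⊛ shift b) ⊛ c) n +ᶻ ((shift a ⊛ b) ⊛ c) n)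
    ≡⟨ cong (λ t → a₀b₀ *ᶻ c (suc n) +ᶻ (t +ᶻ ((shift a ⊛ b) ⊛ c) n))
            (trans (⊛-assoc (C (a 0)) (shift b) c n) (C-⊛ (a 0) (shift b ⊛ c) n)) ⟩
  a₀b₀ *ᶻ c (suc n) +ᶻ (a 0 *ᶻ (shift b ⊛ c) n +ᶻ ((shift a ⊛ b) ⊛ c) n)
    ≡⟨ cong (λ t → a₀b₀ *ᶻ c (suc n) +ᶻ (a 0 *ᶻ (shift b ⊛ c) n +ᶻ t))
            (⊛-assoc (shift a) b c n) ⟩
  a₀b₀ *ᶻ c (suc n) +ᶻ (a 0 *ᶻ (shift b ⊛ c) n +ᶻ (shift a ⊛ (b ⊛ c)) n)
    ≡⟨ factor (a 0) (b 0) (c (suc n)) ((shift b ⊛ c) n) _ ⟩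
  a 0 *ᶻ (b 0 *ᶻ c (suc n) +ᶻ (shift b ⊛ c) n) +ᶻ (shift a ⊛ (b ⊛ c)) n
    ≡⟨ cong (λ t → a 0 *ᶻ t +ᶻ (shift a ⊛ (b ⊛ c)) n) (sym (⊛-suc b c n)) ⟩
  a 0 *ᶻ (b ⊛ c) (suc n) +ᶻ (shift a ⊛ (b ⊛ c)) n
    ≡⟨ sym (⊛-suc a (b ⊛ c) n) ⟩
  (a ⊛ (b ⊛ c)) (suc n) ∎
  where
  open ≡-Reasoning
  a₀b₀ = a 0 *ᶻ b 0
  factor : ∀ x y z w t → (x *ᶻ y) *ᶻ z +ᶻ (x *ᶻ w +ᶻ t) ≡ x *ᶻ (y *ᶻ z +ᶻ w) +ᶻ t
  factor = solve-∀

⊛-identityˡ : ∀ a → (one ⊛ a) ≈ a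
⊛-identityˡ a n =
  trans (⊛-cong one≈C1 (≈-refl {a}) n) (trans (C-⊛ (+ 1) a n) (ℤₚ.*-identityˡ (a n)))

⊛-identityʳ : ∀ a → (a ⊛ one) ≈ a
⊛-identityʳ a = ≈-trans (⊛-comm a one) (⊛-identityˡ a)

-- ≈ is a Π-type from which Agda cannot recover the two series; wrapping it in a
-- record makes them inferable, which the ring solver and the ring lemmas rely on.
infix 4 _≋_
record _≋_ (a b : PS) : Set where
  constructor ≈⇒≋
  field ≋⇒≈ : a ≈ b
open _≋_ public

module _ where
  open Algebra.Structures {A = PS} _≋_

  isCommutativeRing : IsCommutativeRing _⊕_ _⊛_ ⊝_ 𝟘 one
  isCommutativeRing = record
    { isRing = record
      { +-isAbelianGroup = record
        { isGroup = record
          { isMonoid = record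
            { isSemigroup = record
              { isMagma = record
                { isEquivalence = record
                  { refl  = ≈⇒≋ ≈-refl
                  ; sym   = λ p → ≈⇒≋ (≈-sym (≋⇒≈ p))
                  ; trans = λ p q → ≈⇒≋ (≈-trans (≋⇒≈ p) (≋⇒≈ q))
                  }
                ; ∙-cong = λ p q → ≈⇒≋ (λ n → cong₂ _+ᶻ_ (≋⇒≈ p n) (≋⇒≈ q n))
                }
              ; assoc = λ a b c → ≈⇒≋ (λ n → ℤₚ.+-assoc (a n) (b n) (c n))
              }
            ; identity = (λ a → ≈⇒≋ (λ n → ℤₚ.+-identityˡ (a n)))
                       , (λ a → ≈⇒≋ (λ n → ℤₚ.+-identityʳ (a n)))
            }
          ; inverse = (λ a → ≈⇒≋ (λ n → ℤₚ.+-inverseˡ (a n)))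
                    , (λ a → ≈⇒≋ (λ n → ℤₚ.+-inverseʳ (a n)))
          ; ⁻¹-cong = λ p → ≈⇒≋ (λ n → cong -ᶻ_ (≋⇒≈ p n))
          }
        ; comm = λ a b → ≈⇒≋ (λ n → ℤₚ.+-comm (a n) (b n))
        }
      ; *-cong     = λ p q → ≈⇒≋ (⊛-cong (≋⇒≈ p) (≋⇒≈ q))
      ; *-assoc    = λ a b c → ≈⇒≋ (⊛-assoc a b c)
      ; *-identity = (λ a → ≈⇒≋ (⊛-identityˡ a)) , (λ a → ≈⇒≋ (⊛-identityʳ a))
      ; distrib    = (λ a b c → ≈⇒≋ (⊛-distribˡ a b c)) , (λ a b c → ≈⇒≋ (⊛-distribʳ a b c))
      }
    ; *-comm = λ a b → ≈⇒≋ (⊛-comm a b)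
    }

ring : CommutativeRing _ _
ring = record { isCommutativeRing = isCommutativeRing }

module R = CommutativeRing ring
module ≋-Reasoning = SetoidReasoning R.setoid

module PS-Solver where
  C-homomorphism : CommutativeRing.rawRing ℤₚ.+-*-commutativeRing
                   ACR.-Raw-AlmostCommutative⟶ ACR.fromCommutativeRing ring
  C-homomorphism = record
    { ⟦_⟧    = C
    ; +-homo = λ a b → ≈⇒≋ (λ { zero → refl ; (suc n) → refl })
    ; *-homo = λ a b → ≈⇒≋ (λ n → sym (trans (C-⊛ a (C b) n) (C-* a b n)))
    ; -‿homo = λ a → ≈⇒≋ (λ { zero → refl ; (suc n) → refl })
    ; 0-homo = ≈⇒≋ (λ { zero → refl ; (suc n) → refl })
    ; 1-homo = ≈⇒≋ (λ { zero → refl ; (suc n) → refl })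
    }
    where
    C-* : ∀ a b n → a *ᶻ C b n ≡ C (a *ᶻ b) n
    C-* a b zero    = refl
    C-* a b (suc n) = ℤₚ.*-zeroʳ a

  C-≟ : ∀ a b → Maybe (C a ≋ C b)
  C-≟ a b with a ℤₚ.≟ b
  ... | yes refl = just R.refl
  ... | no _     = nothing

  open import Algebra.Solver.Ring _ _ C-homomorphism C-≟ public

open PS-Solver using (solve; _:=_; _:*_; _:+_; :-_)

⊛-congˡ : ∀ a {b b′} → b ≋ b′ → a ⊛ b ≋ a ⊛ b′
⊛-congˡ a = R.*-cong (R.refl {a})

⊛-congʳ : ∀ {a a′} b → a ≋ a′ → a ⊛ b ≋ a′ ⊛ b
⊛-congʳ b a≋a′ = R.*-cong a≋a′ (R.refl {b})

pow-cong : ∀ {a b} m → a ≋ b → pow a m ≋ pow b m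
pow-cong zero    _   = R.refl
pow-cong (suc m) a≋b = R.*-cong a≋b (pow-cong m a≋b)

pow-+ : ∀ a m k → pow a (m + k) ≋ pow a m ⊛ pow a k
pow-+ a zero    k = R.sym (R.*-identityˡ (pow a k))
pow-+ a (suc m) k = R.trans (⊛-congˡ a (pow-+ a m k)) (R.sym (R.*-assoc a (pow a m) (pow a k)))

pow-⊛ : ∀ a b m → pow (a ⊛ b) m ≋ pow a m ⊛ pow b m
pow-⊛ a b zero    = R.sym (R.*-identityˡ one)
pow-⊛ a b (suc m) = begin
  (a ⊛ b) ⊛ pow (a ⊛ b) m        ≈⟨ ⊛-congˡ (a ⊛ b) (pow-⊛ a b m) ⟩
  (a ⊛ b) ⊛ (pow a m ⊛ pow b m)  ≈⟨ solve 4 (λ a b x y → (a :* b) :* (x :* y) := (a :* x) :* (b :* y))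
                                           R.refl a b (pow a m) (pow b m) ⟩
  (a ⊛ pow a m) ⊛ (b ⊛ pow b m)  ∎
  where open ≋-Reasoning

pow-one : ∀ m → pow one m ≋ one
pow-one zero    = R.refl
pow-one (suc m) = R.trans (⊛-congˡ one (pow-one m)) (R.*-identityˡ one)

X⊛-suc : ∀ a n → (X ⊛ a) (suc n) ≡ a n
X⊛-suc a n =
  trans (⊛-suc X a n)
        (trans (ℤₚ.+-identityˡ _) (trans (⊛-cong shiftX≈one (≈-refl {a}) n) (⊛-identityˡ a n)))
  where
  shiftX≈one : shift X ≈ one
  shiftX≈one zero    = refl
  shiftX≈one (suc n) = refl

X⊛-cancel : ∀ {a b} → X ⊛ a ≋ X ⊛ b → a ≋ b
X⊛-cancel {a} {b} p = ≈⇒≋ (λ n → trans (sym (X⊛-suc a n)) (trans (≋⇒≈ p (suc n)) (X⊛-suc b n)))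

decompose : ∀ a → a ≋ C (a 0) ⊕ X ⊛ shift a
decompose a = ≈⇒≋ λ
  { zero    → sym (ℤₚ.+-identityʳ (a 0))
  ; (suc n) → sym (trans (ℤₚ.+-identityˡ _) (X⊛-suc (shift a) n))
  }

X⊛shift : ∀ a → a 0 ≡ + 0 → a ≋ X ⊛ shift a
X⊛shift a a₀≡0 = ≈⇒≋ λ
  { zero    → a₀≡0
  ; (suc n) → sym (X⊛-suc (shift a) n)
  }

⊛-cong<ʳ : ∀ a {b b′} → a 0 ≡ + 0 → ∀ N → (∀ i → i < N → b i ≡ b′ i) → (a ⊛ b) N ≡ (a ⊛ b′) N
⊛-cong<ʳ a {b} {b′} a₀≡0 zero    _  = trans (cong (_*ᶻ b 0) a₀≡0) (sym (cong (_*ᶻ b′ 0) a₀≡0))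
⊛-cong<ʳ a {b} {b′} a₀≡0 (suc M) eq = begin
  (a ⊛ b) (suc M)
    ≡⟨ ⊛-suc a b M ⟩
  a 0 *ᶻ b (suc M) +ᶻ (shift a ⊛ b) M
    ≡⟨ cong₂ (λ x y → x *ᶻ b (suc M) +ᶻ y) a₀≡0 (⊛-cong≤ʳ (shift a) M (λ i i≤M → eq i (s≤s i≤M))) ⟩
  + 0 *ᶻ b′ (suc M) +ᶻ (shift a ⊛ b′) M
    ≡⟨ cong (λ x → x *ᶻ b′ (suc M) +ᶻ (shift a ⊛ b′) M) (sym a₀≡0) ⟩
  a 0 *ᶻ b′ (suc M) +ᶻ (shift a ⊛ b′) M
    ≡⟨ sym (⊛-suc a b′ M) ⟩
  (a ⊛ b′) (suc M) ∎
  where open ≡-Reasoning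

X^⊛-shift : ∀ j m a → (pow X j ⊛ a) (j + m) ≡ a m
X^⊛-shift zero    m a = ⊛-identityˡ a m
X^⊛-shift (suc j) m a =
  trans (⊛-assoc X (pow X j) a (suc (j + m)))
        (trans (X⊛-suc (pow X j ⊛ a) (j + m)) (X^⊛-shift j m a))

X^⊛-low : ∀ j m a → m < j → (pow X j ⊛ a) m ≡ + 0
X^⊛-low (suc j) zero    a _ = ⊛-assoc X (pow X j) a 0
X^⊛-low (suc j) (suc m) a (s≤s m<j) =
  trans (⊛-assoc X (pow X j) a (suc m)) (trans (X⊛-suc (pow X j ⊛ a) m) (X^⊛-low j m a m<j))

⊛-pow-X⊛ : ∀ a b m → a ⊛ pow (X ⊛ b) m ≋ pow X m ⊛ (a ⊛ pow b m)
⊛-pow-X⊛ a b m =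
  R.trans (⊛-congˡ a (pow-⊛ X b m))
          (solve 3 (λ a x p → a :* (x :* p) := x :* (a :* p)) R.refl a (pow X m) (pow b m))

⊛-pow-X⊛-shift : ∀ a b m N → (a ⊛ pow (X ⊛ b) m) (m + N) ≡ (a ⊛ pow b m) N
⊛-pow-X⊛-shift a b m N = trans (≋⇒≈ (⊛-pow-X⊛ a b m) (m + N)) (X^⊛-shift m N (a ⊛ pow b m))

⊛-pow-X⊛-low : ∀ a b m i → i < m → (a ⊛ pow (X ⊛ b) m) i ≡ + 0
⊛-pow-X⊛-low a b m i i<m = trans (≋⇒≈ (⊛-pow-X⊛ a b m) i) (X^⊛-low m i (a ⊛ pow b m) i<m)

-- The Euler operator θ = x d/dx

θ : PS → PS
θ a n = + n *ᶻ a n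

θ-cong : ∀ {a b} → a ≋ b → θ a ≋ θ b
θ-cong a≋b = ≈⇒≋ (λ n → cong (+ n *ᶻ_) (≋⇒≈ a≋b n))

θ-⊛ : ∀ a b → θ (a ⊛ b) ≋ θ a ⊛ b ⊕ a ⊛ θ b
θ-⊛ a b = ≈⇒≋ λ n →
  trans (sumTo-*ˡ n (+ n) _)
        (trans (sumTo-cong≤ n (λ i i≤n →
                  trans (cong (λ t → + t *ᶻ (a i *ᶻ b (n ∸ i))) (sym (ℕₚ.m+[n∸m]≡n i≤n)))
                        (leibniz (+ i) (+ (n ∸ i)) (a i) (b (n ∸ i)))))
               (sumTo-+ n _ _))
  where
  leibniz : ∀ i j x y → (i +ᶻ j) *ᶻ (x *ᶻ y) ≡ (i *ᶻ x) *ᶻ y +ᶻ x *ᶻ (j *ᶻ y)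
  leibniz = solve-∀

θ-one : θ one ≋ 𝟘
θ-one = ≈⇒≋ λ { zero → refl ; (suc n) → ℤₚ.*-zeroʳ (+ suc n) }

θ-X : θ X ≋ X
θ-X = ≈⇒≋ λ { zero → refl ; (suc zero) → refl ; (suc (suc n)) → ℤₚ.*-zeroʳ (+ suc (suc n)) }

X⊛deriv : ∀ a → X ⊛ deriv a ≋ θ a
X⊛deriv a = ≈⇒≋ λ { zero → refl ; (suc n) → X⊛-suc (deriv a) n }

-- Substitution of a series without constant term

module Substitution (φ : PS) (φ₀≡0 : φ 0 ≡ + 0) where

  pow-φ-low : ∀ j m → m < j → pow φ j m ≡ + 0
  pow-φ-low j m m<j =
    trans (≋⇒≈ (R.trans (pow-cong j (X⊛shift φ φ₀≡0)) (pow-⊛ X (shift φ) j)) m)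
          (X^⊛-low j m (pow (shift φ) j) m<j)

  -- Since φ^j has order j, the sum defining [x^i] a(φ) may be extended from j ≤ i to j ≤ N.
  compose-⊛-coeff : ∀ a w N → (compose a φ ⊛ w) N ≡ sumTo N (λ j → a j *ᶻ (pow φ j ⊛ w) N)
  compose-⊛-coeff a w N = begin
    sumTo N (λ i → sumTo i (λ j → a j *ᶻ pow φ j i) *ᶻ w (N ∸ i))
      ≡⟨ sumTo-cong≤ N (λ i i≤N → cong (_*ᶻ w (N ∸ i)) (extend i≤N)) ⟩
    sumTo N (λ i → sumTo N (λ j → a j *ᶻ pow φ j i) *ᶻ w (N ∸ i))
      ≡⟨ sumTo-cong N (λ i → sumTo-*ʳ N (w (N ∸ i)) _) ⟩
    sumTo N (λ i → sumTo N (λ j → a j *ᶻ pow φ j i *ᶻ w (N ∸ i)))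
      ≡⟨ sumTo-swap N N _ ⟩
    sumTo N (λ j → sumTo N (λ i → a j *ᶻ pow φ j i *ᶻ w (N ∸ i)))
      ≡⟨ sumTo-cong N (λ j → trans (sumTo-cong N (λ i → ℤₚ.*-assoc (a j) _ _))
                                   (sym (sumTo-*ˡ N (a j) _))) ⟩
    sumTo N (λ j → a j *ᶻ (pow φ j ⊛ w) N) ∎
    where
    open ≡-Reasoning
    extend : ∀ {i} → i ≤ N → sumTo i (λ j → a j *ᶻ pow φ j i) ≡ sumTo N (λ j → a j *ᶻ pow φ j i)
    extend {i} i≤N =
      trans (sumTo-pad i (N ∸ i) (λ j i<j →
               trans (cong (a j *ᶻ_) (pow-φ-low j i i<j)) (ℤₚ.*-zeroʳ (a j))))
            (cong (λ t → sumTo t (λ j → a j *ᶻ pow φ j i)) (ℕₚ.m+[n∸m]≡n i≤N))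

  compose-cong : ∀ {a b} → a ≋ b → compose a φ ≋ compose b φ
  compose-cong a≋b = ≈⇒≋ λ n → sumTo-cong n (λ k → cong (_*ᶻ pow φ k n) (≋⇒≈ a≋b k))

  compose-⊕ : ∀ a b → compose (a ⊕ b) φ ≋ compose a φ ⊕ compose b φ
  compose-⊕ a b = ≈⇒≋ λ n →
    trans (sumTo-cong n (λ k → ℤₚ.*-distribʳ-+ (pow φ k n) (a k) (b k))) (sumTo-+ n _ _)

  compose-C⊛ : ∀ c b → compose (C c ⊛ b) φ ≋ C c ⊛ compose b φ
  compose-C⊛ c b = ≈⇒≋ λ n → begin
    sumTo n (λ k → (C c ⊛ b) k *ᶻ pow φ k n)  ≡⟨ sumTo-cong n (λ k → trans (cong (_*ᶻ pow φ k n) (C-⊛ c b k))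
                                                                             (ℤₚ.*-assoc c (b k) _)) ⟩
    sumTo n (λ k → c *ᶻ (b k *ᶻ pow φ k n))    ≡⟨ sym (sumTo-*ˡ n c _) ⟩
    c *ᶻ compose b φ n                         ≡⟨ sym (C-⊛ c (compose b φ) n) ⟩
    (C c ⊛ compose b φ) n                      ∎
    where open ≡-Reasoning

  compose-C : ∀ c → compose (C c) φ ≋ C c
  compose-C c = ≈⇒≋ λ
    { zero    → ℤₚ.*-identityʳ c
    ; (suc n) → trans (sumTo-suc n _)
                      (cong₂ _+ᶻ_ (ℤₚ.*-zeroʳ c) (sumTo-zero n (λ i _ → refl)))
    }

  compose-X⊛ : ∀ c → compose (X ⊛ c) φ ≋ φ ⊛ compose c φ
  compose-X⊛ c = ≈⇒≋ λ
    { zero    → sym (cong (_*ᶻ compose c φ 0) φ₀≡0)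
    ; (suc M) → begin
        compose (X ⊛ c) φ (suc M)
          ≡⟨ trans (sumTo-suc M _) (ℤₚ.+-identityˡ _) ⟩
        sumTo M (λ k → (X ⊛ c) (suc k) *ᶻ pow φ (suc k) (suc M))
          ≡⟨ sumTo-cong M (λ k → cong₂ _*ᶻ_ (X⊛-suc c k) (⊛-comm φ (pow φ k) (suc M))) ⟩
        sumTo M (λ k → c k *ᶻ (pow φ k ⊛ φ) (suc M))
          ≡⟨ sym (trans (cong (sumTo M (λ k → c k *ᶻ (pow φ k ⊛ φ) (suc M)) +ᶻ_) top-term≡0)
                     (ℤₚ.+-identityʳ _)) ⟩
        sumTo (suc M) (λ k → c k *ᶻ (pow φ k ⊛ φ) (suc M))
          ≡⟨ sym (compose-⊛-coeff c φ (suc M)) ⟩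
        (compose c φ ⊛ φ) (suc M)
          ≡⟨ ⊛-comm (compose c φ) φ (suc M) ⟩
        (φ ⊛ compose c φ) (suc M) ∎
    }
    where
    open ≡-Reasoning
    top-term≡0 : ∀ {M} → c (suc M) *ᶻ (pow φ (suc M) ⊛ φ) (suc M) ≡ + 0
    top-term≡0 {M} =
      trans (cong (c (suc M) *ᶻ_) (trans (⊛-comm (pow φ (suc M)) φ (suc M))
                                         (pow-φ-low (suc (suc M)) (suc M) ℕₚ.≤-refl)))
            (ℤₚ.*-zeroʳ (c (suc M)))

  -- Strong induction on the coefficient: writing a = a₀ + x a′, the coefficient N of
  -- φ · (a′ b)(φ) only involves coefficients of (a′ b)(φ) below N.
  compose-⊛ : ∀ a b → compose (a ⊛ b) φ ≋ compose a φ ⊛ compose b φ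
  compose-⊛ a b = ≈⇒≋ (λ N → <-rec Multiplicative step N a b)
    where
    Multiplicative : ℕ → Set
    Multiplicative N = ∀ a b → compose (a ⊛ b) φ N ≡ (compose a φ ⊛ compose b φ) N

    step : ∀ N → (∀ {i} → i < N → Multiplicative i) → Multiplicative N
    step N IH a b = begin
      compose (a ⊛ b) φ N
        ≡⟨ ≋⇒≈ (compose-cong (R.trans (⊛-congʳ b (decompose a)) split)) N ⟩
      compose (C (a 0) ⊛ b ⊕ X ⊛ (shift a ⊛ b)) φ N
        ≡⟨ ≋⇒≈ (R.trans (compose-⊕ (C (a 0) ⊛ b) (X ⊛ (shift a ⊛ b)))
                        (R.+-cong (compose-C⊛ (a 0) b) (compose-X⊛ (shift a ⊛ b)))) N ⟩
      (C (a 0) ⊛ B) N +ᶻ (φ ⊛ compose (shift a ⊛ b) φ) N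
        ≡⟨ cong ((C (a 0) ⊛ B) N +ᶻ_) (trans (⊛-cong<ʳ φ φ₀≡0 N (λ i i<N → IH i<N (shift a) b))
                                               (sym (⊛-assoc φ A′ B N))) ⟩
      (C (a 0) ⊛ B) N +ᶻ ((φ ⊛ A′) ⊛ B) N
        ≡⟨ sym (⊛-distribʳ B (C (a 0)) (φ ⊛ A′) N) ⟩
      ((C (a 0) ⊕ φ ⊛ A′) ⊛ B) N
        ≡⟨ sym (≋⇒≈ (⊛-congʳ B A≋) N) ⟩
      (compose a φ ⊛ B) N ∎
      where
      open ≡-Reasoning
      A′ = compose (shift a) φ
      B  = compose b φ
      split : (C (a 0) ⊕ X ⊛ shift a) ⊛ b ≋ C (a 0) ⊛ b ⊕ X ⊛ (shift a ⊛ b)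
      split = solve 4 (λ c x s b → (c :+ x :* s) :* b := c :* b :+ x :* (s :* b))
                      R.refl (C (a 0)) X (shift a) b
      A≋ : compose a φ ≋ C (a 0) ⊕ φ ⊛ A′
      A≋ = R.trans (compose-cong (decompose a))
                   (R.trans (compose-⊕ (C (a 0)) (X ⊛ shift a))
                            (R.+-cong (compose-C (a 0)) (compose-X⊛ (shift a))))

  compose-one : compose one φ ≋ one
  compose-one =
    R.trans (compose-cong (≈⇒≋ one≈C1)) (R.trans (compose-C (+ 1)) (≈⇒≋ (≈-sym one≈C1)))

  compose-pow : ∀ a m → compose (pow a m) φ ≋ pow (compose a φ) m
  compose-pow a zero    = compose-one
  compose-pow a (suc m) = R.trans (compose-⊛ a (pow a m)) (⊛-congˡ (compose a φ) (compose-pow a m))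

module Inverse (u v : PS) (uv≋1 : u ⊛ v ≋ one) where

  pow-inverse : ∀ m → pow u m ⊛ pow v m ≋ one
  pow-inverse m = R.trans (R.sym (pow-⊛ u v m)) (R.trans (pow-cong m uv≋1) (pow-one m))

  pow-inverse-cancel : ∀ m n → pow u (m + n) ⊛ pow v n ≋ pow u m
  pow-inverse-cancel m n = begin
    pow u (m + n) ⊛ pow v n               ≈⟨ ⊛-congʳ (pow v n) (pow-+ u m n) ⟩
    (pow u m ⊛ pow u n) ⊛ pow v n         ≈⟨ R.*-assoc (pow u m) (pow u n) (pow v n) ⟩
    pow u m ⊛ (pow u n ⊛ pow v n)         ≈⟨ ⊛-congˡ (pow u m) (pow-inverse n) ⟩
    pow u m ⊛ one                         ≈⟨ R.*-identityʳ (pow u m) ⟩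
    pow u m                               ∎
    where open ≋-Reasoning

  θ-inverse : θ v ≋ ⊝ ((v ⊛ v) ⊛ θ u)
  θ-inverse = begin
    θ v                                        ≈⟨ R.sym (R.*-identityˡ (θ v)) ⟩
    one ⊛ θ v                                  ≈⟨ ⊛-congʳ (θ v) (R.sym uv≋1) ⟩
    (u ⊛ v) ⊛ θ v                              ≈⟨ solve 4 (λ u v θu θv → (u :* v) :* θv
                                                    := v :* (θu :* v :+ u :* θv) :+ (:- ((v :* v) :* θu)))
                                                    R.refl u v (θ u) (θ v) ⟩
    v ⊛ (θ u ⊛ v ⊕ u ⊛ θ v) ⊕ ⊝ ((v ⊛ v) ⊛ θ u) ≈⟨ R.+-cong (⊛-congˡ v θ[uv]≋0) R.refl ⟩
    v ⊛ 𝟘 ⊕ ⊝ ((v ⊛ v) ⊛ θ u)                  ≈⟨ R.+-cong (R.zeroʳ v) R.refl ⟩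
    𝟘 ⊕ ⊝ ((v ⊛ v) ⊛ θ u)                      ≈⟨ R.+-identityˡ _ ⟩
    ⊝ ((v ⊛ v) ⊛ θ u)                          ∎
    where
    open ≋-Reasoning
    θ[uv]≋0 : θ u ⊛ v ⊕ u ⊛ θ v ≋ 𝟘
    θ[uv]≋0 = R.trans (R.sym (θ-⊛ u v)) (R.trans (θ-cong uv≋1) θ-one)

  θ-pow-inverse : ∀ e → θ (pow v e) ≋ ⊝ (C (+ e) ⊛ (pow v (suc e) ⊛ θ u))
  θ-pow-inverse zero    =
    R.trans θ-one (≈⇒≋ λ n → cong -ᶻ_ (sym (C-⊛ (+ 0) (pow v 1 ⊛ θ u) n)))
  θ-pow-inverse (suc e) = begin
    θ (v ⊛ V)
      ≈⟨ θ-⊛ v V ⟩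
    θ v ⊛ V ⊕ v ⊛ θ V
      ≈⟨ R.+-cong (⊛-congʳ V θ-inverse) (⊛-congˡ v (θ-pow-inverse e)) ⟩
    (⊝ ((v ⊛ v) ⊛ θ u)) ⊛ V ⊕ v ⊛ (⊝ (C (+ e) ⊛ ((v ⊛ V) ⊛ θ u)))
      ≈⟨ solve 4 (λ v θu V c → (:- ((v :* v) :* θu)) :* V :+ v :* (:- (c :* ((v :* V) :* θu)))
                             := :- ((PS-Solver.con (+ 1) :+ c) :* ((v :* (v :* V)) :* θu)))
                 R.refl v (θ u) V (C (+ e)) ⟩
    ⊝ ((C (+ 1) ⊕ C (+ e)) ⊛ ((v ⊛ (v ⊛ V)) ⊛ θ u))
      ≈⟨ R.-‿cong (⊛-congʳ ((v ⊛ (v ⊛ V)) ⊛ θ u) C[1+e]) ⟩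
    ⊝ (C (+ suc e) ⊛ ((v ⊛ (v ⊛ V)) ⊛ θ u)) ∎
    where
    open ≋-Reasoning
    V = pow v e
    C[1+e] : C (+ 1) ⊕ C (+ e) ≋ C (+ suc e)
    C[1+e] = ≈⇒≋ λ { zero → refl ; (suc n) → refl }

-- Lagrange inversion

module Lagrange (φ u v : PS) (φ≋Xu : φ ≋ X ⊛ u) (uv≋1 : u ⊛ v ≋ one) where

  open Inverse u v uv≋1

  φ₀≡0 : φ 0 ≡ + 0
  φ₀≡0 = ≋⇒≈ φ≋Xu 0

  open Substitution φ φ₀≡0

  pow-suc⊛deriv : ∀ m → pow v (suc m) ⊛ deriv φ ≋ pow v m ⊕ pow v (suc m) ⊛ θ u
  pow-suc⊛deriv m = X⊛-cancel (begin
    X ⊛ ((v ⊛ V) ⊛ deriv φ)       ≈⟨ solve 4 (λ x v V d → x :* ((v :* V) :* d) := (v :* V) :* (x :* d))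
                                             R.refl X v V (deriv φ) ⟩
    (v ⊛ V) ⊛ (X ⊛ deriv φ)       ≈⟨ ⊛-congˡ (v ⊛ V) (R.trans (X⊛deriv φ) (θ-cong φ≋Xu)) ⟩
    (v ⊛ V) ⊛ θ (X ⊛ u)           ≈⟨ ⊛-congˡ (v ⊛ V)
                                             (R.trans (θ-⊛ X u) (R.+-cong (⊛-congʳ u θ-X) R.refl)) ⟩
    (v ⊛ V) ⊛ (X ⊛ u ⊕ X ⊛ θ u)   ≈⟨ solve 5 (λ v V x u θu → (v :* V) :* (x :* u :+ x :* θu)
                                                         := x :* ((u :* v) :* V :+ (v :* V) :* θu))
                                             R.refl v V X u (θ u) ⟩
    X ⊛ ((u ⊛ v) ⊛ V ⊕ (v ⊛ V) ⊛ θ u)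
      ≈⟨ ⊛-congˡ X (R.+-cong (R.trans (⊛-congʳ V uv≋1) (R.*-identityˡ V))
                             (R.refl {(v ⊛ V) ⊛ θ u})) ⟩
    X ⊛ (V ⊕ (v ⊛ V) ⊛ θ u)       ∎)
    where
    open ≋-Reasoning
    V = pow v m

  -- With v = x/φ, the coefficient [x^e] v^(e+1) φ′ is the residue of φ′/φ^(e+1).
  residue-one : (pow v 1 ⊛ deriv φ) 0 ≡ + 1
  residue-one = begin
    (v 0 *ᶻ + 1) *ᶻ (+ 1 *ᶻ φ 1)  ≡⟨ cong₂ _*ᶻ_ (ℤₚ.*-identityʳ (v 0))
                                            (trans (ℤₚ.*-identityˡ (φ 1)) (trans (≋⇒≈ φ≋Xu 1) (X⊛-suc u 0))) ⟩
    v 0 *ᶻ u 0                     ≡⟨ ℤₚ.*-comm (v 0) (u 0) ⟩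
    u 0 *ᶻ v 0                     ≡⟨ ≋⇒≈ uv≋1 0 ⟩
    + 1                            ∎
    where open ≡-Reasoning

  residue-vanishes : ∀ e → (pow v (suc (suc e)) ⊛ deriv φ) (suc e) ≡ + 0
  residue-vanishes e = ℤₚ.*-cancelˡ-≡ (+ suc e) (Z (suc e)) (+ 0) (begin
    + suc e *ᶻ Z (suc e)
      ≡⟨ cong (+ suc e *ᶻ_) (≋⇒≈ (pow-suc⊛deriv (suc e)) (suc e)) ⟩
    + suc e *ᶻ (V (suc e) +ᶻ W (suc e))
      ≡⟨ ℤₚ.*-distribˡ-+ (+ suc e) (V (suc e)) (W (suc e)) ⟩
    θ V (suc e) +ᶻ + suc e *ᶻ W (suc e)
      ≡⟨ cong (_+ᶻ + suc e *ᶻ W (suc e)) (trans (≋⇒≈ (θ-pow-inverse (suc e)) (suc e))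
                                                 (cong -ᶻ_ (C-⊛ (+ suc e) W (suc e)))) ⟩
    -ᶻ (+ suc e *ᶻ W (suc e)) +ᶻ + suc e *ᶻ W (suc e)
      ≡⟨ ℤₚ.+-inverseˡ (+ suc e *ᶻ W (suc e)) ⟩
    + 0
      ≡⟨ sym (ℤₚ.*-zeroʳ (+ suc e)) ⟩
    + suc e *ᶻ + 0 ∎)
    where
    open ≡-Reasoning
    Z = pow v (suc (suc e)) ⊛ deriv φ
    V = pow v (suc e)
    W = pow v (suc (suc e)) ⊛ θ u

  pow-φ⊛deriv-pow : ∀ j e →
    pow φ j ⊛ (deriv φ ⊛ pow v (suc (j + e))) ≋ pow X j ⊛ (pow v (suc e) ⊛ deriv φ)
  pow-φ⊛deriv-pow j e = begin
    pow φ j ⊛ (deriv φ ⊛ pow v (suc (j + e)))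
      ≈⟨ R.*-cong (R.trans (pow-cong j φ≋Xu) (pow-⊛ X u j))
                  (⊛-congˡ (deriv φ)
                    (R.trans (≈⇒≋ (λ n → cong (λ t → pow v t n) (sym (ℕₚ.+-suc j e)))) (pow-+ v j (suc e)))) ⟩
    (pow X j ⊛ pow u j) ⊛ (deriv φ ⊛ (pow v j ⊛ pow v (suc e)))
      ≈⟨ solve 5 (λ x U d V P → (x :* U) :* (d :* (V :* P)) := x :* ((U :* V) :* (P :* d)))
                 R.refl (pow X j) (pow u j) (deriv φ) (pow v j) (pow v (suc e)) ⟩
    pow X j ⊛ ((pow u j ⊛ pow v j) ⊛ (pow v (suc e) ⊛ deriv φ))
      ≈⟨ ⊛-congˡ (pow X j) (R.trans (⊛-congʳ (pow v (suc e) ⊛ deriv φ) (pow-inverse j))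
                                      (R.*-identityˡ (pow v (suc e) ⊛ deriv φ))) ⟩
    pow X j ⊛ (pow v (suc e) ⊛ deriv φ) ∎
    where open ≋-Reasoning

  lagrange-inversion : ∀ a N → a N ≡ (compose a φ ⊛ (deriv φ ⊛ pow v (suc N))) N
  lagrange-inversion a N = sym (begin
    (compose a φ ⊛ W) N                  ≡⟨ compose-⊛-coeff a W N ⟩
    sumTo N (λ j → a j *ᶻ (pow φ j ⊛ W) N) ≡⟨ sumTo-last N lower-terms≡0 ⟩
    a N *ᶻ (pow φ N ⊛ W) N               ≡⟨ cong (a N *ᶻ_) (trans (term N 0 (sym (ℕₚ.+-identityʳ N)))
                                                                 residue-one) ⟩
    a N *ᶻ + 1                           ≡⟨ ℤₚ.*-identityʳ (a N) ⟩
    a N                                  ∎)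
    where
    open ≡-Reasoning
    W = deriv φ ⊛ pow v (suc N)

    term : ∀ j e → N ≡ j + e → (pow φ j ⊛ W) N ≡ (pow v (suc e) ⊛ deriv φ) e
    term j e refl =
      trans (≋⇒≈ (pow-φ⊛deriv-pow j e) (j + e)) (X^⊛-shift j e (pow v (suc e) ⊛ deriv φ))

    lower-terms≡0 : ∀ j → j < N → a j *ᶻ (pow φ j ⊛ W) N ≡ + 0
    lower-terms≡0 j j<N with ℕₚ.m≤n⇒∃[o]m+o≡n j<N
    ... | o , 1+j+o≡N =
      trans (cong (a j *ᶻ_) (trans (term j (suc o) (sym (trans (ℕₚ.+-suc j o) 1+j+o≡N)))
                                   (residue-vanishes o)))
            (ℤₚ.*-zeroʳ (a j))

-- The central Riordan array

module Central (g f h φ q : PS) (f₀≡1 : f 0 ≡ + 1) (hf≋X : h ⊛ f ≋ X)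
               (φ₀≡0 : φ 0 ≡ + 0) (h∘φ≋X : compose h φ ≋ X)
               (q⊛u≋g∘φ : q ⊛ compose f φ ≋ compose g φ) where

  open Substitution φ φ₀≡0

  h₀≡0 : h 0 ≡ + 0
  h₀≡0 = trans (sym (ℤₚ.*-identityʳ (h 0))) (trans (cong (h 0 *ᶻ_) (sym f₀≡1)) (≋⇒≈ hf≋X 0))

  -- h = x r with r = 1/f, and u = f∘φ, v = r∘φ = 1/u = x/φ.
  r u v : PS
  r = shift h
  u = compose f φ
  v = compose r φ

  r⊛f≋1 : r ⊛ f ≋ one
  r⊛f≋1 = X⊛-cancel (begin
    X ⊛ (r ⊛ f)   ≈⟨ R.sym (R.*-assoc X r f) ⟩
    (X ⊛ r) ⊛ f   ≈⟨ ⊛-congʳ f (R.sym (X⊛shift h h₀≡0)) ⟩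
    h ⊛ f         ≈⟨ hf≋X ⟩
    X             ≈⟨ R.sym (R.*-identityʳ X) ⟩
    X ⊛ one       ∎)
    where open ≋-Reasoning

  u⊛v≋1 : u ⊛ v ≋ one
  u⊛v≋1 = R.trans (R.sym (compose-⊛ f r))
                  (R.trans (compose-cong (R.trans (R.*-comm f r) r⊛f≋1)) compose-one)

  φ⊛v≋X : φ ⊛ v ≋ X
  φ⊛v≋X = R.trans (R.sym (compose-X⊛ r)) (R.trans (compose-cong (R.sym (X⊛shift h h₀≡0))) h∘φ≋X)

  φ≋X⊛u : φ ≋ X ⊛ u
  φ≋X⊛u = begin
    φ             ≈⟨ R.sym (R.*-identityʳ φ) ⟩
    φ ⊛ one       ≈⟨ ⊛-congˡ φ (R.sym u⊛v≋1) ⟩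
    φ ⊛ (u ⊛ v)   ≈⟨ solve 3 (λ p u v → p :* (u :* v) := (p :* v) :* u) R.refl φ u v ⟩
    (φ ⊛ v) ⊛ u   ≈⟨ ⊛-congʳ u φ⊛v≋X ⟩
    X ⊛ u         ∎
    where open ≋-Reasoning

  open Inverse u v u⊛v≋1 using (pow-inverse-cancel)
  open Lagrange φ u v φ≋X⊛u u⊛v≋1 using (lagrange-inversion)

  g⊛f^[2k+N]∘φ : ∀ k N →
    compose (g ⊛ pow f (k + N + k)) φ ⊛ (deriv φ ⊛ pow v (suc N)) ≋ (deriv φ ⊛ q) ⊛ pow (u ⊛ u) k
  g⊛f^[2k+N]∘φ k N = begin
    compose (g ⊛ pow f M) φ ⊛ (deriv φ ⊛ pow v (suc N))
      ≈⟨ ⊛-congʳ (deriv φ ⊛ pow v (suc N))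
                 (R.trans (compose-⊛ g (pow f M)) (R.*-cong (R.sym q⊛u≋g∘φ) (compose-pow f M))) ⟩
    ((q ⊛ u) ⊛ pow u M) ⊛ (deriv φ ⊛ pow v (suc N))
      ≈⟨ solve 5 (λ q u U d V → ((q :* u) :* U) :* (d :* V) := (d :* q) :* ((u :* U) :* V))
                 R.refl q u (pow u M) (deriv φ) (pow v (suc N)) ⟩
    (deriv φ ⊛ q) ⊛ (pow u (suc M) ⊛ pow v (suc N))
      ≈⟨ ⊛-congˡ (deriv φ ⊛ q) u^[1+M]⊛v^[1+N]≋u^2k ⟩
    (deriv φ ⊛ q) ⊛ pow (u ⊛ u) k ∎
    where
    open ≋-Reasoning
    M = k + N + k
    1+M≡2k+1+N : ∀ k N → suc (k + N + k) ≡ (k + k) + suc N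
    1+M≡2k+1+N = ℕ-Solver.solve-∀
    u^[1+M]⊛v^[1+N]≋u^2k : pow u (suc M) ⊛ pow v (suc N) ≋ pow (u ⊛ u) k
    u^[1+M]⊛v^[1+N]≋u^2k = begin
      pow u (suc M) ⊛ pow v (suc N)            ≈⟨ ⊛-congʳ (pow v (suc N))
                                                     (≈⇒≋ (λ n → cong (λ t → pow u t n) (1+M≡2k+1+N k N))) ⟩
      pow u ((k + k) + suc N) ⊛ pow v (suc N)  ≈⟨ pow-inverse-cancel (k + k) (suc N) ⟩
      pow u (k + k)                            ≈⟨ pow-+ u k k ⟩
      pow u k ⊛ pow u k                        ≈⟨ R.sym (pow-⊛ u u k) ⟩
      pow (u ⊛ u) k                            ∎

  φ⊛u≋X⊛u² : φ ⊛ u ≋ X ⊛ (u ⊛ u)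
  φ⊛u≋X⊛u² = R.trans (⊛-congʳ u φ≋X⊛u) (R.*-assoc X u u)

  riordan-φ⊛u : ∀ d n k → riordan d (φ ⊛ u) n k ≡ (d ⊛ pow (X ⊛ (u ⊛ u)) k) n
  riordan-φ⊛u d n k = ≋⇒≈ (⊛-congˡ d (pow-cong k φ⊛u≋X⊛u²)) n

  central-entry : ∀ n k → riordan g (X ⊛ f) (2 * n) (n + k) ≡ riordan (deriv φ ⊛ q) (φ ⊛ u) n k
  central-entry n k with k ≤? n
  ... | no k≰n =
    trans (⊛-pow-X⊛-low g f (n + k) (2 * n) (2n<n+k (ℕₚ.≰⇒> k≰n)))
          (sym (trans (riordan-φ⊛u (deriv φ ⊛ q) n k)
                      (⊛-pow-X⊛-low (deriv φ ⊛ q) (u ⊛ u) k n (ℕₚ.≰⇒> k≰n))))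
    where
    2n<n+k : n < k → 2 * n < n + k
    2n<n+k n<k = ℕₚ.+-monoʳ-< n (subst (_< k) (sym (ℕₚ.+-identityʳ n)) n<k)
  ... | yes k≤n with ℕₚ.m≤n⇒∃[o]m+o≡n k≤n
  ...   | N , refl = begin
    (g ⊛ pow (X ⊛ f) M) (2 * (k + N))
      ≡⟨ cong (g ⊛ pow (X ⊛ f) M) (2[k+N]≡M+N k N) ⟩
    (g ⊛ pow (X ⊛ f) M) (M + N)
      ≡⟨ ⊛-pow-X⊛-shift g f M N ⟩
    (g ⊛ pow f M) N
      ≡⟨ lagrange-inversion (g ⊛ pow f M) N ⟩
    (compose (g ⊛ pow f M) φ ⊛ (deriv φ ⊛ pow v (suc N))) N
      ≡⟨ ≋⇒≈ (g⊛f^[2k+N]∘φ k N) N ⟩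
    ((deriv φ ⊛ q) ⊛ pow (u ⊛ u) k) N
      ≡⟨ sym (⊛-pow-X⊛-shift (deriv φ ⊛ q) (u ⊛ u) k N) ⟩
    ((deriv φ ⊛ q) ⊛ pow (X ⊛ (u ⊛ u)) k) (k + N)
      ≡⟨ sym (riordan-φ⊛u (deriv φ ⊛ q) (k + N) k) ⟩
    ((deriv φ ⊛ q) ⊛ pow (φ ⊛ u) k) (k + N) ∎
    where
    open ≡-Reasoning
    M = k + N + k
    2[k+N]≡M+N : ∀ k N → 2 * (k + N) ≡ k + N + k + N
    2[k+N]≡M+N = ℕ-Solver.solve-∀

mainTheorem2 : (g f : PS) → g 0 ≡ + 1 → f 0 ≡ + 1 →
    (h : PS) → (h ⊛ f) ≈ X →
    (φ : PS) → φ 0 ≡ + 0 → compose h φ ≈ X →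
    (q : PS) → (q ⊛ compose f φ) ≈ compose g φ →
    ∀ n k → riordan g (X ⊛ f) (2 * n) (n + k)
            ≡ riordan (deriv φ ⊛ q) (φ ⊛ compose f φ) n k
mainTheorem2 g f _ f₀≡1 h hf≈X φ φ₀≡0 h∘φ≈X q q⊛u≈g∘φ =
  Central.central-entry g f h φ q f₀≡1 (≈⇒≋ hf≈X) φ₀≡0 (≈⇒≋ h∘φ≈X) (≈⇒≋ q⊛u≈g∘φ)
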